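{- Let $\mathcal C$ be a category and let $J$ and $I$ be collections of morphisms of $\mathcal C$. Suppose $I$ is wellfounded and $(J,I)$ has the shift property. Then the $(J,I)$-seed order on the objects of $\mathcal C$ is wellfounded (there is no sequence of objects $u_0>u_1>u_2>\cdots$).
   Context: $I$ is wellfounded if there is no sequence $\langle i_n:n<\omega\rangle$ of elements of $I$ with $\mathrm{cod}(i_n)=\mathrm{dom}(i_{n+1})$ for all $n$. $(J,I)$ has the shift property if for every $j:v\to w$ in $J$ and every $i:v\to u$ in $I$ there is an object $x$ with morphisms $i':w\to x$ in $I$ and $j':u\to x$ in $J$. The $(J,I)$-seed order is defined on objects by $u<w$ iff there is an object $x$ with morphisms $j:u\to x$ in $J$ and $i:w\to x$ in $I$. -}

module Defs where

open import Level using (Level; _⊔_; suc)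
open import Data.Nat using (ℕ) renaming (suc to sucℕ)
open import Data.Product using (Σ; ∃; _×_; _,_)
open import Relation.Binary.PropositionalEquality using (_≡_)
open import Relation.Nullary using (¬_)

record Category (o h : Level) : Set (Level.suc (o ⊔ h)) where
  infixr 9 _∘_
  field
    Obj   : Set o
    Hom   : Obj → Obj → Set h
    id    : ∀ {a} → Hom a a
    _∘_   : ∀ {a b c} → Hom b c → Hom a b → Hom a c
    identityˡ : ∀ {a b} (f : Hom a b) → id ∘ f ≡ f
    identityʳ : ∀ {a b} (f : Hom a b) → f ∘ id ≡ f
    assoc : ∀ {a b c d} (f : Hom c d) (g : Hom b c) (k : Hom a b) →
            (f ∘ g) ∘ k ≡ f ∘ (g ∘ k)

module _ {o h : Level} (C : Category o h) where
  open Category C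

  MorClass : (p : Level) → Set (o ⊔ h ⊔ Level.suc p)
  MorClass p = ∀ {a b} → Hom a b → Set p

  -- I is wellfounded: no sequence ⟨ i_n ⟩ in I with cod(i_n) = dom(i_{n+1}).
  -- Such a sequence is given by objects obj n and morphisms
  -- i n : obj n → obj (n+1), all in I.
  WellfoundedClass : ∀ {p} → MorClass p → Set (o ⊔ h ⊔ p)
  WellfoundedClass I =
    ¬ (Σ (ℕ → Obj) λ obj →
         Σ ((n : ℕ) → Hom (obj n) (obj (sucℕ n))) λ i →
           (n : ℕ) → I (i n))

  ShiftProperty : ∀ {p q} → MorClass p → MorClass q → Set (o ⊔ h ⊔ p ⊔ q)
  ShiftProperty J I =
    ∀ {v w u} (j : Hom v w) (i : Hom v u) → J j → I i →
      Σ Obj λ x → Σ (Hom w x) λ i' → Σ (Hom u x) λ j' → I i' × J j'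

  SeedLt : ∀ {p q} → MorClass p → MorClass q → Obj → Obj → Set (o ⊔ h ⊔ p ⊔ q)
  SeedLt J I u w =
    Σ Obj λ x → Σ (Hom u x) λ j → Σ (Hom w x) λ i → J j × I i

  SeedOrderWellfounded : ∀ {p q} → MorClass p → MorClass q → Set (o ⊔ h ⊔ p ⊔ q)
  SeedOrderWellfounded J I =
    ¬ (Σ (ℕ → Obj) λ u → (n : ℕ) → SeedLt J I (u (sucℕ n)) (u n))

-- Idea.  A descending seed chain u₀ > u₁ > u₂ > ⋯ is a zigzag
--
--     u₀        u₁        u₂
--      i₀ ↘   ↙ j₀ i₁ ↘  ↙ j₁ ⋯          (iₙ ∈ I, jₙ ∈ J)
--           x₀          x₁
--
-- with iₙ : uₙ → xₙ and jₙ : uₙ₊₁ → xₙ.  Applying the shift property to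
-- each cospan formed by jₙ and iₙ₊₁ (both leaving uₙ₊₁) completes it to a
-- square, and the far sides of these squares form a new zigzag whose
-- lower objects are the xₙ.  Iterating builds an infinite staircase; the
-- first I-morphism of each zigzag goes from its first object to the first
-- object of the next zigzag, so these morphisms form an infinite chain in
-- I, contradicting wellfoundedness of I.

module Submission where

open import Defs
open import Level using (Level; _⊔_)
open import Data.Nat using (ℕ; zero) renaming (suc to sucℕ)
open import Data.Product using (Σ; _×_; _,_)

module SeedOrder {o h p q : Level} (C : Category o h)
    (J : MorClass C p) (I : MorClass C q) where
  open Category C

  record Zigzag : Set (o ⊔ h ⊔ p ⊔ q) where
    field
      lower upper : ℕ → Obj
      down        : ∀ n → Hom (lower n) (upper n)
      down∈I      : ∀ n → I (down n)
      back        : ∀ n → Hom (lower (sucℕ n)) (upper n)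
      back∈J      : ∀ n → J (back n)
  open Zigzag

  descendingZigzag : (u : ℕ → Obj) → (∀ n → SeedLt C J I (u (sucℕ n)) (u n)) →
                     Zigzag
  descendingZigzag u lt = record
    { lower  = u
    ; upper  = λ n → let (x , _) = lt n in x
    ; down   = λ n → let (_ , _ , i , _) = lt n in i
    ; down∈I = λ n → let (_ , _ , _ , _ , i∈I) = lt n in i∈I
    ; back   = λ n → let (_ , j , _) = lt n in j
    ; back∈J = λ n → let (_ , _ , _ , j∈J , _) = lt n in j∈J
    }

  -- The new
  -- zigzag's lower objects are the old upper objects, so its first
  -- down-morphism starts where the old one ended.
  shift : ShiftProperty C J I → Zigzag → Zigzag
  shift sh z = record
    { lower  = upper z
    ; upper  = λ n → let (x , _) = square n in x
    ; down   = λ n → let (_ , i' , _) = square n in i'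
    ; down∈I = λ n → let (_ , _ , _ , i'∈I , _) = square n in i'∈I
    ; back   = λ n → let (_ , _ , j' , _) = square n in j'
    ; back∈J = λ n → let (_ , _ , _ , _ , j'∈J) = square n in j'∈J
    }
    where
    square : ∀ n → Σ Obj λ x → Σ (Hom (upper z n) x) λ i' →
                   Σ (Hom (upper z (sucℕ n)) x) λ j' → I i' × J j'
    square n = sh (back z n) (down z (sucℕ n)) (back∈J z n) (down∈I z (sucℕ n))

  staircase : ShiftProperty C J I → Zigzag → ℕ → Zigzag
  staircase sh z zero     = z
  staircase sh z (sucℕ r) = shift sh (staircase sh z r)

  -- The first down-morphisms of the staircase form an infinite I-chain,
  -- since lower (staircase (r+1)) 0 is by definition upper (staircase r) 0.
  firstColumnChain : ShiftProperty C J I → Zigzag →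
    Σ (ℕ → Obj) λ obj →
      Σ ((n : ℕ) → Hom (obj n) (obj (sucℕ n))) λ i → (n : ℕ) → I (i n)
  firstColumnChain sh z =
      (λ r → lower (staircase sh z r) 0)
    , (λ r → down (staircase sh z r) 0)
    , (λ r → down∈I (staircase sh z r) 0)

mainTheorem12 : ∀ {o h p q : Level} (C : Category o h)
    (J : MorClass C p) (I : MorClass C q) →
    WellfoundedClass C I → ShiftProperty C J I → SeedOrderWellfounded C J I
mainTheorem12 C J I wf sh (u , descending) =
  wf (firstColumnChain sh (descendingZigzag u descending))
  where open SeedOrder C J I
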